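{- Let $G=(U,V,E)$ be a complete bipartite graph with edge labels in $\{\pm1\}$, $m=|U|$, $n=|V|$, and let $0<\epsilon\le1$. Let $\mathcal{C}_\star$ be a clustering of $U\cup V$ (with any number of clusters) maximizing the number of agreements. Then there exists a clustering $\mathcal{C}$ of $U\cup V$ with at most $k=2\epsilon^{ -1}+2$ clusters such that $\mathrm{Agree}(\mathcal{C})\ge\mathrm{Agree}(\mathcal{C}_\star)-\epsilon nm$.
   Context: For a clustering $\mathcal{C}$ of $U\cup V$, $\mathrm{Agree}(\mathcal{C})$ is the number of $+1$ edges with both endpoints in the same cluster plus the number of $-1$ edges with endpoints in different clusters. -}

module Defs where

open import Data.Nat using (ℕ; zero; suc; _+_)
open import Data.Nat.Properties using (_≟_)
open import Data.Fin using (Fin)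
import Data.Fin as F
open import Data.Sum using (_⊎_; inj₁; inj₂)
open import Data.Sign using (Sign)
import Data.Sign as S
open import Relation.Nullary using (yes; no)

sumFin : (n : ℕ) → (Fin n → ℕ) → ℕ
sumFin zero    f = 0
sumFin (suc n) f = f F.zero + sumFin n (λ i → f (F.suc i))

Vertex : ℕ → ℕ → Set
Vertex m n = Fin m ⊎ Fin n

Labelling : ℕ → ℕ → Set
Labelling m n = Fin m → Fin n → Sign

-- a clustering of U ∪ V: each vertex gets a cluster name (a natural number);
-- two vertices are in the same cluster iff they get the same name.
Clustering : ℕ → ℕ → Set
Clustering m n = Vertex m n → ℕ

agreeEdge : Sign → ℕ → ℕ → ℕ
agreeEdge S.+ a b with a ≟ b
... | yes _ = 1
... | no  _ = 0
agreeEdge S.- a b with a ≟ b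
... | yes _ = 0
... | no  _ = 1

Agree : {m n : ℕ} → Labelling m n → Clustering m n → ℕ
Agree {m} {n} σ C =
  sumFin m (λ u → sumFin n (λ v → agreeEdge (σ u v) (C (inj₁ u)) (C (inj₂ v))))

AtMostClusters : {m n : ℕ} → ℕ → Clustering m n → Set
AtMostClusters {m} {n} k C = (x : Vertex m n) → C x Data.Nat.< k

module Submission where

-- Fix a threshold t and call a cluster heavy if it contains more than t
-- vertices of V.  Heavy clusters are disjoint, so there are at most n/(t+1)
-- of them.  Keep every heavy cluster, put all remaining U-vertices into one
-- new cluster and all remaining V-vertices into another.  An edge changes
-- its status only if both endpoints lie in the same light cluster; each
-- u ∈ U has at most t such partners, so at most m·t agreements are lost.
-- With ε = p/(d+1) and t = ⌊p·n/(d+1)⌋ the loss is ≤ ε·n·m, and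
-- p·n < (t+1)(d+1) forces fewer than 1/ε heavy clusters.

open import Defs
open import Data.Nat using (ℕ)
open import Data.Product using (Σ; _×_)
open import Data.Integer using (+_)
open import Data.Rational using (ℚ; _≤_; _+_; _-_; _*_; _÷_; 1ℚ; Positive; _/_)
open import Data.Rational.Properties using (pos⇒nonZero)

open import Data.Nat as ℕ using (suc; zero; z≤n; s≤s; _≟_)
import Data.Nat.Properties as ℕP
open import Data.Nat.DivMod using (m/n*n≤m; m≡m%n+[m/n]*n; m%n<n)
open import Data.Nat.Coprimality as Coprimality using (Coprime)
open import Data.Nat.Tactic.RingSolver as ℕSolver using ()
import Data.Integer as ℤ
import Data.Integer.Properties as ℤP
open import Data.Integer.Tactic.RingSolver as ℤSolver using ()
open import Data.Rational using (mkℚ; -_; toℚᵘ; 0ℚ)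
open import Data.Rational.Properties
  using ( toℚᵘ-injective; toℚᵘ-fromℚᵘ; toℚᵘ-homo-+; toℚᵘ-homo-*; toℚᵘ-cancel-≤
        ; normalize-pos; *-cancelʳ-≤-pos; *-comm; *-assoc; +-assoc; +-inverseʳ
        ; +-identityʳ; +-monoˡ-≤; +-monoʳ-≤; module ≤-Reasoning)
import Data.Rational.Unnormalised as ℚᵘ
import Data.Rational.Unnormalised.Properties as ℚᵘP
open import Data.Fin using (Fin; toℕ)
import Data.Fin as F
open import Data.Fin.Properties using (toℕ<n; toℕ-injective)
open import Data.Sum using (inj₁; inj₂)
import Data.Sign as S
open import Data.List using (List; []; _∷_; length; lookup)
open import Data.List.Membership.DecPropositional _≟_ using (_∈_; _∉_; _∈?_)
open import Data.List.Relation.Unary.Any using (here; there; index)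
open import Data.List.Relation.Unary.Any.Properties using (lookup-index)
open import Data.Product using (_,_)
open import Data.Empty using (⊥-elim; ⊥-elim-irr)
open import Relation.Nullary using (Dec; yes; no; ¬_)
open import Relation.Binary.PropositionalEquality

indicator : {P : Set} → Dec P → ℕ
indicator (yes _) = 1
indicator (no _)  = 0

indicator-yes : {P : Set} → P → (d : Dec P) → indicator d ≡ 1
indicator-yes p (yes _) = refl
indicator-yes p (no ¬p) = ⊥-elim (¬p p)

indicator-no : {P : Set} → ¬ P → (d : Dec P) → indicator d ≡ 0
indicator-no ¬p (yes p) = ⊥-elim (¬p p)
indicator-no ¬p (no _)  = refl

indicator≤1 : {P : Set} (d : Dec P) → indicator d ℕ.≤ 1
indicator≤1 (yes _) = ℕP.≤-refl
indicator≤1 (no _)  = z≤n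

indicator-cong : {P Q : Set} → (P → Q) → (Q → P) → (d : Dec P) (e : Dec Q) →
                 indicator d ≡ indicator e
indicator-cong P→Q Q→P (yes p) e = sym (indicator-yes (P→Q p) e)
indicator-cong P→Q Q→P (no ¬p) e = sym (indicator-no (λ q → ¬p (Q→P q)) e)

sumFin-cong : ∀ n {f g : Fin n → ℕ} → (∀ i → f i ≡ g i) → sumFin n f ≡ sumFin n g
sumFin-cong zero    eq = refl
sumFin-cong (suc n) eq = cong₂ ℕ._+_ (eq F.zero) (sumFin-cong n (λ i → eq (F.suc i)))

sumFin-mono : ∀ n {f g : Fin n → ℕ} → (∀ i → f i ℕ.≤ g i) → sumFin n f ℕ.≤ sumFin n g
sumFin-mono zero    le = z≤n
sumFin-mono (suc n) le = ℕP.+-mono-≤ (le F.zero) (sumFin-mono n (λ i → le (F.suc i)))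

sumFin-+ : ∀ n (f g : Fin n → ℕ) →
           sumFin n (λ i → f i ℕ.+ g i) ≡ sumFin n f ℕ.+ sumFin n g
sumFin-+ zero    f g = refl
sumFin-+ (suc n) f g = begin
  f₀ ℕ.+ g₀ ℕ.+ sumFin n (λ i → f (F.suc i) ℕ.+ g (F.suc i))
    ≡⟨ cong (f₀ ℕ.+ g₀ ℕ.+_) (sumFin-+ n _ _) ⟩
  f₀ ℕ.+ g₀ ℕ.+ (Σf ℕ.+ Σg)
    ≡⟨ interchange f₀ g₀ Σf Σg ⟩
  f₀ ℕ.+ Σf ℕ.+ (g₀ ℕ.+ Σg) ∎
  where
  open ≡-Reasoning
  f₀ g₀ Σf Σg : ℕ
  f₀ = f F.zero
  g₀ = g F.zero
  Σf = sumFin n (λ i → f (F.suc i))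
  Σg = sumFin n (λ i → g (F.suc i))
  interchange : ∀ a b c e → a ℕ.+ b ℕ.+ (c ℕ.+ e) ≡ a ℕ.+ c ℕ.+ (b ℕ.+ e)
  interchange = ℕSolver.solve-∀

sumFin-≤-* : ∀ n c {f : Fin n → ℕ} → (∀ i → f i ℕ.≤ c) → sumFin n f ℕ.≤ n ℕ.* c
sumFin-≤-* zero    c le = z≤n
sumFin-≤-* (suc n) c le = ℕP.+-mono-≤ (le F.zero) (sumFin-≤-* n c (λ i → le (F.suc i)))

agreeEdge-invariant : ∀ s {a b c e} → (a ≡ b → c ≡ e) → (c ≡ e → a ≡ b) →
                      agreeEdge s a b ≡ agreeEdge s c e
agreeEdge-invariant S.+ {a} {b} {c} {e} to from with a ≟ b | c ≟ e
... | yes _   | yes _   = refl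
... | no _    | no _    = refl
... | yes a≡b | no c≢e  = ⊥-elim (c≢e (to a≡b))
... | no a≢b  | yes c≡e = ⊥-elim (a≢b (from c≡e))
agreeEdge-invariant S.- {a} {b} {c} {e} to from with a ≟ b | c ≟ e
... | yes _   | yes _   = refl
... | no _    | no _    = refl
... | yes a≡b | no c≢e  = ⊥-elim (c≢e (to a≡b))
... | no a≢b  | yes c≡e = ⊥-elim (a≢b (from c≡e))

agreeEdge≤1 : ∀ s a b → agreeEdge s a b ℕ.≤ 1
agreeEdge≤1 S.+ a b with a ≟ b
... | yes _ = ℕP.≤-refl
... | no _  = z≤n
agreeEdge≤1 S.- a b with a ≟ b
... | yes _ = z≤n
... | no _  = ℕP.≤-refl

slot : List ℕ → ℕ → ℕ → ℕ
slot K δ c with c ∈? K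
... | yes c∈K = toℕ (index c∈K)
... | no _    = length K ℕ.+ δ

collapse : ∀ {m n} → List ℕ → Clustering m n → Clustering m n
collapse K C (inj₁ u) = slot K 0 (C (inj₁ u))
collapse K C (inj₂ v) = slot K 1 (C (inj₂ v))

slot-bound : ∀ K δ c → slot K δ c ℕ.≤ length K ℕ.+ δ
slot-bound K δ c with c ∈? K
... | yes c∈K = ℕP.≤-trans (ℕP.<⇒≤ (toℕ<n (index c∈K))) (ℕP.m≤m+n (length K) δ)
... | no _    = ℕP.≤-refl

collapse-clusters : ∀ {m n} K (C : Clustering m n) → AtMostClusters (length K ℕ.+ 2) (collapse K C)
collapse-clusters K C (inj₁ u) = ℕP.≤-<-trans (slot-bound K 0 _) (ℕP.+-monoʳ-< (length K) (s≤s z≤n))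
collapse-clusters K C (inj₂ v) = ℕP.≤-<-trans (slot-bound K 1 _) (ℕP.+-monoʳ-< (length K) (s≤s (s≤s z≤n)))

slot-injective : ∀ K a b → slot K 0 a ≡ slot K 1 b → a ≡ b
slot-injective K a b eq with a ∈? K | b ∈? K
... | yes a∈K | yes b∈K =
  trans (lookup-index a∈K) (trans (cong (lookup K) (toℕ-injective eq)) (sym (lookup-index b∈K)))
... | yes a∈K | no _ =
  ⊥-elim (ℕP.<-irrefl eq (ℕP.≤-trans (toℕ<n (index a∈K)) (ℕP.m≤m+n (length K) 1)))
... | no _ | yes b∈K =
  ⊥-elim (ℕP.<-irrefl (sym eq) (ℕP.≤-trans (toℕ<n (index b∈K)) (ℕP.m≤m+n (length K) 0)))
... | no _ | no _ =
  ⊥-elim (ℕP.<-irrefl eq (ℕP.+-monoʳ-< (length K) (s≤s z≤n)))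

slot-kept : ∀ K a → a ∈ K → slot K 0 a ≡ slot K 1 a
slot-kept K a a∈K with a ∈? K
... | yes _   = refl
... | no a∉K  = ⊥-elim (a∉K a∈K)

-- dropped K a b = 1 iff a = b is a name outside K: exactly the edges inside a
-- non-kept cluster, the only edges whose status the collapse may change
dropped : List ℕ → ℕ → ℕ → ℕ
dropped K a b with a ∈? K
... | yes _ = 0
... | no _  = indicator (a ≟ b)

dropped-kept : ∀ K a b → a ∈ K → dropped K a b ≡ 0
dropped-kept K a b a∈K with a ∈? K
... | yes _  = refl
... | no a∉K = ⊥-elim (a∉K a∈K)

dropped-free : ∀ K a b → a ∉ K → dropped K a b ≡ indicator (a ≟ b)
dropped-free K a b a∉K with a ∈? K
... | yes a∈K = ⊥-elim (a∉K a∈K)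
... | no _    = refl

edge-loss : ∀ K s a b →
            agreeEdge s a b ℕ.≤ agreeEdge s (slot K 0 a) (slot K 1 b) ℕ.+ dropped K a b
edge-loss K s a b = by-cases (a ∈? K) (a ≟ b)
  where
  preserved : (a ≡ b → a ∈ K) → agreeEdge s a b ≡ agreeEdge s (slot K 0 a) (slot K 1 b)
  preserved kept = agreeEdge-invariant s
    (λ a≡b → trans (slot-kept K a (kept a≡b)) (cong (slot K 1) a≡b)) (slot-injective K a b)

  without-loss : dropped K a b ≡ 0 → (a ≡ b → a ∈ K) →
                 agreeEdge s a b ℕ.≤ agreeEdge s (slot K 0 a) (slot K 1 b) ℕ.+ dropped K a b
  without-loss no-loss kept = ℕP.≤-reflexive (trans (preserved kept)
    (sym (trans (cong (agreeEdge s (slot K 0 a) (slot K 1 b) ℕ.+_) no-loss) (ℕP.+-identityʳ _))))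

  by-cases : Dec (a ∈ K) → Dec (a ≡ b) →
             agreeEdge s a b ℕ.≤ agreeEdge s (slot K 0 a) (slot K 1 b) ℕ.+ dropped K a b
  by-cases (yes a∈K) _         = without-loss (dropped-kept K a b a∈K) (λ _ → a∈K)
  by-cases (no a∉K)  (no a≢b)  =
    without-loss (trans (dropped-free K a b a∉K) (indicator-no a≢b _)) (λ a≡b → ⊥-elim (a≢b a≡b))
  by-cases (no a∉K)  (yes a≡b) = ℕP.≤-trans (agreeEdge≤1 s a b)
    (ℕP.≤-trans (ℕP.≤-reflexive (sym (trans (dropped-free K a b a∉K) (indicator-yes a≡b _))))
                (ℕP.m≤n+m _ _))

agree-collapse : ∀ {m n} (σ : Labelling m n) K (C : Clustering m n) →
  Agree σ C ℕ.≤ Agree σ (collapse K C)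
                ℕ.+ sumFin m (λ u → sumFin n (λ v → dropped K (C (inj₁ u)) (C (inj₂ v))))
agree-collapse {m} {n} σ K C =
  ℕP.≤-trans (sumFin-mono m (λ u → ℕP.≤-trans (sumFin-mono n (λ v → edge-loss K (σ u v) _ _))
                                               (ℕP.≤-reflexive (sumFin-+ n _ _))))
             (ℕP.≤-reflexive (sumFin-+ m _ _))

occupancy : ∀ {n} → (Fin n → ℕ) → ℕ → ℕ
occupancy {n} g c = sumFin n (λ v → indicator (c ≟ g v))

keptMass : ∀ {n} → (Fin n → ℕ) → List ℕ → ℕ
keptMass {n} g K = sumFin n (λ v → indicator (g v ∈? K))

keptMass≤n : ∀ {n} (g : Fin n → ℕ) K → keptMass g K ℕ.≤ n
keptMass≤n {n} g K = ℕP.≤-trans (sumFin-≤-* n 1 (λ v → indicator≤1 (g v ∈? K)))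
                                (ℕP.≤-reflexive (ℕP.*-identityʳ n))

member-cons : ∀ x K b → x ∉ K →
              indicator (b ∈? x ∷ K) ≡ indicator (x ≟ b) ℕ.+ indicator (b ∈? K)
member-cons x K b x∉K with x ≟ b
... | yes refl = trans (indicator-yes (here refl) _) (cong suc (sym (indicator-no x∉K _)))
... | no x≢b   = indicator-cong (λ { (here b≡x) → ⊥-elim (x≢b (sym b≡x)) ; (there b∈K) → b∈K })
                                there _ _

keptMass-cons : ∀ {n} (g : Fin n → ℕ) x K → x ∉ K →
                keptMass g (x ∷ K) ≡ occupancy g x ℕ.+ keptMass g K
keptMass-cons {n} g x K x∉K =
  trans (sumFin-cong n (λ v → member-cons x K (g v) x∉K)) (sumFin-+ n _ _)

occupancy-tail : ∀ {n} (g : Fin (suc n) → ℕ) c → c ≢ g F.zero →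
                 occupancy g c ≡ occupancy (λ v → g (F.suc v)) c
occupancy-tail g c c≢g₀ =
  cong (ℕ._+ occupancy (λ v → g (F.suc v)) c) (indicator-no c≢g₀ (c ≟ g F.zero))

-- Scan the vertices, keeping a cluster as soon as it is
-- seen to be heavy.
heavy-clusters : ∀ t n (g : Fin n → ℕ) → Σ (List ℕ) λ K →
  (length K ℕ.* suc t ℕ.≤ keptMass g K) × (∀ c → c ∉ K → occupancy g c ℕ.≤ t)
heavy-clusters t zero g = [] , z≤n , λ _ _ → z≤n
heavy-clusters t (suc n) g with heavy-clusters t n (λ v → g (F.suc v))
... | K , mass , light = extend (g₀ ∈? K) (occupancy g g₀ ℕP.≤? t)
  where
  g₀ : ℕ
  g₀ = g F.zero

  mass' : length K ℕ.* suc t ℕ.≤ keptMass g K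
  mass' = ℕP.≤-trans mass (ℕP.m≤n+m _ _)

  light' : ∀ c → c ∉ K → c ≢ g₀ → occupancy g c ℕ.≤ t
  light' c c∉K c≢g₀ = ℕP.≤-trans (ℕP.≤-reflexive (occupancy-tail g c c≢g₀)) (light c c∉K)

  extend : Dec (g₀ ∈ K) → Dec (occupancy g g₀ ℕ.≤ t) → Σ (List ℕ) λ K' →
    (length K' ℕ.* suc t ℕ.≤ keptMass g K') × (∀ c → c ∉ K' → occupancy g c ℕ.≤ t)
  extend (yes g₀∈K) _ =
    K , mass' , λ c c∉K → light' c c∉K (λ { refl → c∉K g₀∈K })
  extend (no g₀∉K) (yes g₀-light) =
    K , mass' , λ c c∉K → by-name c c∉K (c ≟ g₀)
    where
    by-name : ∀ c → c ∉ K → Dec (c ≡ g₀) → occupancy g c ℕ.≤ t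
    by-name c c∉K (yes refl) = g₀-light
    by-name c c∉K (no c≢g₀)  = light' c c∉K c≢g₀
  extend (no g₀∉K) (no g₀-heavy) =
    g₀ ∷ K ,
    ℕP.≤-trans (ℕP.+-mono-≤ (ℕP.≰⇒> g₀-heavy) mass')
               (ℕP.≤-reflexive (sym (keptMass-cons g g₀ K g₀∉K))) ,
    λ c c∉g₀K → light' c (λ c∈K → c∉g₀K (there c∈K)) (λ c≡g₀ → c∉g₀K (here c≡g₀))

row-loss : ∀ {n} t K (g : Fin n → ℕ) → (∀ c → c ∉ K → occupancy g c ℕ.≤ t) →
           ∀ a → sumFin n (λ v → dropped K a (g v)) ℕ.≤ t
row-loss {n} t K g light a = by-membership (a ∈? K)
  where
  by-membership : Dec (a ∈ K) → sumFin n (λ v → dropped K a (g v)) ℕ.≤ t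
  by-membership (yes a∈K) =
    ℕP.≤-trans (sumFin-≤-* n 0 (λ v → ℕP.≤-reflexive (dropped-kept K a (g v) a∈K)))
               (subst (ℕ._≤ t) (sym (ℕP.*-zeroʳ n)) z≤n)
  by-membership (no a∉K) =
    ℕP.≤-trans (ℕP.≤-reflexive (sumFin-cong n (λ v → dropped-free K a (g v) a∉K))) (light a a∉K)

coarsening : ∀ {m n} t (σ : Labelling m n) (C : Clustering m n) → Σ (List ℕ) λ K →
  (length K ℕ.* suc t ℕ.≤ n) × (Agree σ C ℕ.≤ Agree σ (collapse K C) ℕ.+ m ℕ.* t)
coarsening {m} {n} t σ C with heavy-clusters t n (λ v → C (inj₂ v))
... | K , mass , light =
  K ,
  ℕP.≤-trans mass (keptMass≤n _ K) ,
  ℕP.≤-trans (agree-collapse σ K C)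
             (ℕP.+-monoʳ-≤ (Agree σ (collapse K C))
                           (sumFin-≤-* m t (λ u → row-loss t K (λ v → C (inj₂ v)) light (C (inj₁ u)))))

threshold-below : ∀ p n d → suc d ℕ.* ((p ℕ.* n) ℕ./ suc d) ℕ.≤ p ℕ.* n
threshold-below p n d =
  subst (ℕ._≤ p ℕ.* n) (ℕP.*-comm _ (suc d)) (m/n*n≤m (p ℕ.* n) (suc d))

threshold-above : ∀ p n d → p ℕ.* n ℕ.< suc ((p ℕ.* n) ℕ./ suc d) ℕ.* suc d
threshold-above p n d = begin-strict
  p ℕ.* n                                   ≡⟨ m≡m%n+[m/n]*n (p ℕ.* n) (suc d) ⟩
  (p ℕ.* n) ℕ.% suc d ℕ.+ t ℕ.* suc d       <⟨ ℕP.+-monoˡ-< (t ℕ.* suc d) (m%n<n (p ℕ.* n) (suc d)) ⟩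
  suc d ℕ.+ t ℕ.* suc d                     ≡⟨⟩
  suc t ℕ.* suc d                           ∎
  where
  open ℕP.≤-Reasoning
  t : ℕ
  t = (p ℕ.* n) ℕ./ suc d

few-heavy : ∀ p d t k n → k ℕ.* suc t ℕ.≤ n → p ℕ.* n ℕ.< suc t ℕ.* suc d → p ℕ.* k ℕ.< suc d
few-heavy p d t k n k-heavy pn< = ℕP.*-cancelʳ-< (suc t) (p ℕ.* k) (suc d) (begin-strict
  p ℕ.* k ℕ.* suc t      ≡⟨ ℕP.*-assoc p k (suc t) ⟩
  p ℕ.* (k ℕ.* suc t)    ≤⟨ ℕP.*-monoʳ-≤ p k-heavy ⟩
  p ℕ.* n                <⟨ pn< ⟩
  suc t ℕ.* suc d        ≡⟨ ℕP.*-comm (suc t) (suc d) ⟩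
  suc d ℕ.* suc t        ∎)
  where open ℕP.≤-Reasoning

-- the total loss m·t is at most ε·(n·m) in the cross-multiplied form
threshold-loss : ∀ p n m d t → suc d ℕ.* t ℕ.≤ p ℕ.* n → suc d ℕ.* (m ℕ.* t) ℕ.≤ p ℕ.* (n ℕ.* m)
threshold-loss p n m d t dt≤pn = begin
  suc d ℕ.* (m ℕ.* t)    ≡⟨ swap (suc d) m t ⟩
  m ℕ.* (suc d ℕ.* t)    ≤⟨ ℕP.*-monoʳ-≤ m dt≤pn ⟩
  m ℕ.* (p ℕ.* n)        ≡⟨ rotate m p n ⟩
  p ℕ.* (n ℕ.* m)        ∎
  where
  open ℕP.≤-Reasoning
  swap : ∀ a b c → a ℕ.* (b ℕ.* c) ≡ b ℕ.* (a ℕ.* c)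
  swap = ℕSolver.solve-∀
  rotate : ∀ a b c → a ℕ.* (b ℕ.* c) ≡ b ℕ.* (c ℕ.* a)
  rotate = ℕSolver.solve-∀

ι : ℕ → ℚ
ι a = + a / 1

toℚᵘ-ι : ∀ a → toℚᵘ (ι a) ℚᵘ.≃ ℚᵘ.mkℚᵘ (+ a) 0
toℚᵘ-ι a = toℚᵘ-fromℚᵘ (ℚᵘ.mkℚᵘ (+ a) 0)

ι-+ : ∀ a b → ι (a ℕ.+ b) ≡ ι a + ι b
ι-+ a b = toℚᵘ-injective (ℚᵘP.≃-trans (toℚᵘ-ι (a ℕ.+ b)) (ℚᵘP.≃-trans sum
  (ℚᵘP.≃-sym (ℚᵘP.≃-trans (toℚᵘ-homo-+ (ι a) (ι b)) (ℚᵘP.+-cong (toℚᵘ-ι a) (toℚᵘ-ι b))))))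
  where
  shape : ∀ x y → (x ℤ.+ y) ℤ.* + 1 ≡ (x ℤ.* + 1 ℤ.+ y ℤ.* + 1) ℤ.* + 1
  shape = ℤSolver.solve-∀
  sum : ℚᵘ.mkℚᵘ (+ (a ℕ.+ b)) 0 ℚᵘ.≃ ℚᵘ.mkℚᵘ (+ a) 0 ℚᵘ.+ ℚᵘ.mkℚᵘ (+ b) 0
  sum = ℚᵘ.*≡* (trans (cong (ℤ._* + 1) (ℤP.pos-+ a b)) (shape (+ a) (+ b)))

ι-* : ∀ a b → ι (a ℕ.* b) ≡ ι a * ι b
ι-* a b = toℚᵘ-injective (ℚᵘP.≃-trans (toℚᵘ-ι (a ℕ.* b)) (ℚᵘP.≃-trans product
  (ℚᵘP.≃-sym (ℚᵘP.≃-trans (toℚᵘ-homo-* (ι a) (ι b)) (ℚᵘP.*-cong (toℚᵘ-ι a) (toℚᵘ-ι b))))))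
  where
  product : ℚᵘ.mkℚᵘ (+ (a ℕ.* b)) 0 ℚᵘ.≃ ℚᵘ.mkℚᵘ (+ a) 0 ℚᵘ.* ℚᵘ.mkℚᵘ (+ b) 0
  product = ℚᵘ.*≡* (cong (ℤ._* + 1) (ℤP.pos-* a b))

ι-mono : ∀ {a b} → a ℕ.≤ b → ι a ≤ ι b
ι-mono {a} {b} a≤b = toℚᵘ-cancel-≤
  (ℚᵘP.≤-respˡ-≃ (ℚᵘP.≃-sym (toℚᵘ-ι a)) (ℚᵘP.≤-respʳ-≃ (ℚᵘP.≃-sym (toℚᵘ-ι b))
    (ℚᵘ.*≤* (ℤP.*-monoʳ-≤-nonNeg (+ 1) (ℤ.+≤+ a≤b)))))

fraction-scale : ∀ p d .(c : Coprime p (suc d)) → mkℚ (+ p) d c * ι (suc d) ≡ ι p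
fraction-scale p d c = toℚᵘ-injective (ℚᵘP.≃-trans
  (ℚᵘP.≃-trans (toℚᵘ-homo-* (mkℚ (+ p) d c) (ι (suc d))) (ℚᵘP.*-congˡ (toℚᵘ-ι (suc d))))
  (ℚᵘP.≃-trans cancel (ℚᵘP.≃-sym (toℚᵘ-ι p))))
  where
  cancel : ℚᵘ.mkℚᵘ (+ p) d ℚᵘ.* ℚᵘ.mkℚᵘ (+ suc d) 0 ℚᵘ.≃ ℚᵘ.mkℚᵘ (+ p) 0
  cancel = ℚᵘ.*≡* (trans (ℤP.*-identityʳ (+ p ℤ.* + suc d))
                         (cong (λ k → + p ℤ.* + suc k) (sym (ℕP.*-identityʳ d))))

below-fraction : ∀ p d .(c : Coprime p (suc d)) x y →
                 suc d ℕ.* x ℕ.≤ p ℕ.* y → ι x ≤ mkℚ (+ p) d c * ι y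
below-fraction p d c x y dx≤py = *-cancelʳ-≤-pos (ι (suc d)) {{normalize-pos (suc d) 1}} (begin
  ι x * ι (suc d)          ≡⟨ sym (ι-* x (suc d)) ⟩
  ι (x ℕ.* suc d)          ≡⟨ cong ι (ℕP.*-comm x (suc d)) ⟩
  ι (suc d ℕ.* x)          ≤⟨ ι-mono dx≤py ⟩
  ι (p ℕ.* y)              ≡⟨ ι-* p y ⟩
  ι p * ι y                ≡⟨ cong (_* ι y) (sym (fraction-scale p d c)) ⟩
  ε * ι (suc d) * ι y      ≡⟨ *-assoc ε (ι (suc d)) (ι y) ⟩
  ε * (ι (suc d) * ι y)    ≡⟨ cong (ε *_) (*-comm (ι (suc d)) (ι y)) ⟩
  ε * (ι y * ι (suc d))    ≡⟨ sym (*-assoc ε (ι y) (ι (suc d))) ⟩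
  ε * ι y * ι (suc d)      ∎)
  where
  open ≤-Reasoning
  ε : ℚ
  ε = mkℚ (+ p) d c

-- For ε = (p'+1)/(d+1): (p'+1)·k ≤ 2(d+1) gives k + 2 ≤ 2/ε + 2.  Here
-- 1/ε = (d+1)/(p'+1) holds by definition, so this is cross-multiplication.
cluster-count : ∀ p' d .(c : Coprime (suc p') (suc d)) k →
  suc p' ℕ.* k ℕ.≤ suc d ℕ.* 2 →
  ι (k ℕ.+ 2) ≤ (ι 2 ÷ mkℚ (+ suc p') d c) {{pos⇒nonZero (mkℚ (+ suc p') d c)}} + ι 2
cluster-count p' d c k pk≤2d = begin
  ι (k ℕ.+ 2)        ≡⟨ ι-+ k 2 ⟩
  ι k + ι 2          ≤⟨ +-monoˡ-≤ (ι 2) k≤2/ε ⟩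
  ι 2 * ε⁻¹ + ι 2    ∎
  where
  open ≤-Reasoning
  ε⁻¹ : ℚ
  ε⁻¹ = mkℚ (+ suc d) p' (Coprimality.sym c)
  k≤2/ε : ι k ≤ ι 2 * ε⁻¹
  k≤2/ε = subst (ι k ≤_) (*-comm ε⁻¹ (ι 2)) (below-fraction (suc d) p' (Coprimality.sym c) k 2 pk≤2d)

agreement-bound : ∀ p d .(c : Coprime p (suc d)) A⋆ A L n m →
  A⋆ ℕ.≤ A ℕ.+ L → suc d ℕ.* L ℕ.≤ p ℕ.* (n ℕ.* m) →
  ι A⋆ - mkℚ (+ p) d c * (ι n * ι m) ≤ ι A
agreement-bound p d c A⋆ A L n m A⋆≤A+L loss = begin
  ι A⋆ - w                ≤⟨ +-monoˡ-≤ (- w) (ι-mono A⋆≤A+L) ⟩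
  ι (A ℕ.+ L) - w         ≡⟨ cong (_- w) (ι-+ A L) ⟩
  ι A + ι L - w           ≤⟨ +-monoˡ-≤ (- w) (+-monoʳ-≤ (ι A) L≤w) ⟩
  ι A + w - w             ≡⟨ +-assoc (ι A) w (- w) ⟩
  ι A + (w - w)           ≡⟨ cong (λ z → ι A + z) (+-inverseʳ w) ⟩
  ι A + 0ℚ                ≡⟨ +-identityʳ (ι A) ⟩
  ι A                     ∎
  where
  open ≤-Reasoning
  w : ℚ
  w = mkℚ (+ p) d c * (ι n * ι m)
  L≤w : ι L ≤ w
  L≤w = subst (λ q → ι L ≤ mkℚ (+ p) d c * q) (ι-* n m) (below-fraction p d c L (n ℕ.* m) loss)

-- The theorem.  Write ε = (p'+1)/(d+1) and use the threshold
-- t = ⌊(p'+1)·n/(d+1)⌋ in the combinatorial core.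
lemma5 : (m n : ℕ) (σ : Labelling m n) (ε : ℚ) → .{{_ : Positive ε}} → ε ≤ 1ℚ →
  (Cstar : Clustering m n) →
  ((C' : Clustering m n) → Agree σ C' Data.Nat.≤ Agree σ Cstar) →
  Σ ℕ (λ k → Σ (Clustering m n) (λ C →
    (((+ k) / 1) ≤ (((+ 2) / 1) ÷ ε) {{pos⇒nonZero ε}} + (+ 2) / 1)
    × AtMostClusters k C
    × (((+ Agree σ Cstar) / 1) - ε * (((+ n) / 1) * ((+ m) / 1)) ≤ (+ Agree σ C) / 1)))
lemma5 m n σ (mkℚ (+ zero) _ _)     {{ε>0}} _ _ _ = ⊥-elim-irr (ℤ.Positive.pos ε>0)
lemma5 m n σ (mkℚ ℤ.-[1+ _ ] _ _)  {{ε>0}} _ _ _ = ⊥-elim-irr (ℤ.Positive.pos ε>0)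
lemma5 m n σ (mkℚ (+ suc p') d c) _ C _ with coarsening ((suc p' ℕ.* n) ℕ./ suc d) σ C
... | K , heavy , loss =
  length K ℕ.+ 2 , collapse K C , count , collapse-clusters K C , agreement
  where
  p t : ℕ
  p = suc p'
  t = (p ℕ.* n) ℕ./ suc d

  count : ι (length K ℕ.+ 2) ≤ (ι 2 ÷ mkℚ (+ p) d c) {{pos⇒nonZero (mkℚ (+ p) d c)}} + ι 2
  count = cluster-count p' d c (length K)
    (ℕP.≤-trans (ℕP.<⇒≤ (few-heavy p d t (length K) n heavy (threshold-above p n d)))
                (ℕP.m≤m*n (suc d) 2))

  agreement : ι (Agree σ C) - mkℚ (+ p) d c * (ι n * ι m) ≤ ι (Agree σ (collapse K C))
  agreement = agreement-bound p d c (Agree σ C) (Agree σ (collapse K C)) (m ℕ.* t) n m loss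
    (threshold-loss p n m d t (threshold-below p n d))
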